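{- Let $N \equiv 2 \pmod 4$. Among the partitions of $N$ into exactly two part sizes, the number of those in the parity class $OEEO$ is even. Moreover, the number of partitions of $N$ in $OEEO$ with $\lambda_1 m_1 \equiv 2 \pmod 4$ equals the number of partitions of $N$ in $OEEO$ with $\lambda_2 m_2 \equiv 2 \pmod 4$.
   Context: A partition with exactly two part sizes is written $(\lambda_1^{m_1}\lambda_2^{m_2})$ with $\lambda_1>\lambda_2\ge1$ the part sizes and $m_1,m_2\ge1$ their multiplicities. Its parity class is the word $ABCD$ over $\{O,E\}$ where $A,B,C,D$ record whether $\lambda_1, m_1, \lambda_2, m_2$ respectively are odd ($O$) or even ($E$). (In the paper's notation the two sets in the second claim are $\overline{OE}EO$ and $OE\overline{EO}$, the overline marking the part–multiplicity pair whose product is $2 \pmod 4$.) -}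

module Defs where

open import Data.Nat using (ℕ; zero; suc; _+_; _*_; _<_; _≤_; _≟_; _<?_; _≤?_)
open import Data.Nat.DivMod using (_%_)
open import Data.Product using (_×_; _,_)
open import Data.List using (List; []; _∷_; concatMap; filter; length; upTo; map)
open import Data.Bool using (Bool; true; false; _∧_; not)
open import Relation.Nullary using (does)
open import Data.Bool.Properties using () renaming (_≟_ to _≟B_)
open import Relation.Binary.PropositionalEquality using (_≡_)

-- A partition with exactly two part sizes (λ₁^m₁ λ₂^m₂) is encoded by the
-- quadruple (λ₁ , m₁ , λ₂ , m₂) with λ₁ > λ₂ ≥ 1, m₁ ≥ 1, m₂ ≥ 1.
-- This encoding is a bijection with such partitions.
Quad : Set
Quad = ℕ × ℕ × ℕ × ℕ

IsTwoSizePartitionOf : ℕ → Quad → Set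
IsTwoSizePartitionOf N (l₁ , m₁ , l₂ , m₂) =
  (l₂ < l₁) × (1 ≤ l₂) × (1 ≤ m₁) × (1 ≤ m₂) × (l₁ * m₁ + l₂ * m₂ ≡ N)

isTwoSizePartitionOf? : ℕ → Quad → Bool
isTwoSizePartitionOf? N (l₁ , m₁ , l₂ , m₂) =
  does (l₂ <? l₁) ∧ does (1 ≤? l₂) ∧ does (1 ≤? m₁) ∧ does (1 ≤? m₂)
  ∧ does (l₁ * m₁ + l₂ * m₂ ≟ N)

range1 : ℕ → List ℕ
range1 N = map suc (upTo N)

-- All quadruples with entries in {1,…,N} (every two-size partition of N
-- has all four entries ≤ N).
quads : ℕ → List Quad
quads N = concatMap (λ a → concatMap (λ b → concatMap (λ c → map (λ d → (a , b , c , d))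
            (range1 N)) (range1 N)) (range1 N)) (range1 N)

twoSizePartitions : ℕ → List Quad
twoSizePartitions N = filter (λ q → isTwoSizePartitionOf? N q ≟B true) (quads N)

isOdd : ℕ → Bool
isOdd n = does (n % 2 ≟ 1)

isEven : ℕ → Bool
isEven n = not (isOdd n)

isOEEO : Quad → Bool
isOEEO (l₁ , m₁ , l₂ , m₂) = isOdd l₁ ∧ isEven m₁ ∧ isEven l₂ ∧ isOdd m₂

oeeo : ℕ → List Quad
oeeo N = filter (λ q → isOEEO q ≟B true) (twoSizePartitions N)

oeeo-first2 : ℕ → List Quad
oeeo-first2 N = filter (λ { (l₁ , m₁ , l₂ , m₂) → (l₁ * m₁) % 4 ≟ 2 }) (oeeo N)

oeeo-second2 : ℕ → List Quad
oeeo-second2 N = filter (λ { (l₁ , m₁ , l₂ , m₂) → (l₂ * m₂) % 4 ≟ 2 }) (oeeo N)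

{-# OPTIONS --safe #-}
module Submission where

-- Conjugation (transposing the Ferrers diagram) is an involution on the
-- partitions of N with two part sizes, and it maps OEEO to itself. If a is
-- odd and b even then ab ≡ b (mod 4); so in OEEO we have λ₁m₁ ≡ m₁ and
-- λ₂m₂ ≡ λ₂, while for the conjugate ((m₁+m₂)^λ₂ m₁^(λ₁−λ₂)) these two
-- products are ≡ λ₂ and ≡ m₁. Hence conjugation exchanges the two subsets,
-- which therefore have the same size. Moreover λ₁m₁ and λ₂m₂ are even with sum
-- N ≡ 2 (mod 4), so exactly one of them is ≡ 2 (mod 4): OEEO is the disjoint
-- union of the two subsets, and its size is even.

open import Defs
open import Data.Nat using (ℕ; suc; _+_; _*_; _∸_; _/_; _≤_; s≤s; _%_; _≟_; _<?_; _≤?_; >-nonZero)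
open import Data.Nat.Properties
  using ( +-suc; *-comm; ≤-trans; <⇒≤; m≤m*n; m≤n*m; m≤m+n; m≤n+m; m<m+n; m<n⇒0<n∸m
        ; m+[n∸m]≡n; m+n∸m≡n; suc-injective)
open import Data.Nat.DivMod
  using (m≡m%n+[m/n]*n; m%n<n; m%n*o≡m*o%[n*o]; %-distribˡ-+; %-remove-+ˡ; %-remove-+ʳ)
open import Data.Nat.Divisibility
  using (_∣_; divides; divides-refl; n∣m*n; ∣m⇒∣m*n; ∣n⇒∣m*n; *-pres-∣; m%n≡0⇒n∣m)
open import Data.Nat.Tactic.RingSolver using (solve-∀)
open import Data.Bool using (true)
open import Data.Bool.Properties using () renaming (_≟_ to _≟B_)
open import Data.Empty using (⊥-elim)
open import Data.Product using (_×_; _,_; proj₁; proj₂)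
open import Data.Sum as Sum using (_⊎_; inj₁; inj₂)
open import Data.List using (List; []; _∷_; _++_; map; filter; length; concatMap; cartesianProduct)
open import Data.List.Properties
  using ( length-map; map-∘; map-++; map-id; map-id-local; concatMap-cong
        ; filter-accept; filter-reject)
open import Data.List.Membership.Propositional using (_∈_)
open import Data.List.Membership.Propositional.Properties
  using (∈-map⁺; ∈-map⁻; ∈-filter⁺; ∈-filter⁻; ∈-upTo⁺; ∈-cartesianProduct⁺)
open import Data.List.Membership.Propositional.Properties.WithK using (unique∧set⇒bag)
open import Data.List.Relation.Binary.BagAndSetEquality using (∼bag⇒↭)
open import Data.List.Relation.Binary.Permutation.Propositional.Properties using (↭-length)
open import Data.List.Relation.Unary.Any using (here; there)
import Data.List.Relation.Unary.All as All
open import Data.List.Relation.Unary.Unique.Propositional using (Unique)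
import Data.List.Relation.Unary.Unique.Propositional.Properties as Unique
open import Function using (id; _∘_; _⇔_; mk⇔; Equivalence)
open import Level using (0ℓ)
open import Relation.Nullary using (¬_; Dec; yes; does)
open import Relation.Nullary.Decidable using (dec-true; _×-dec_; ¬?)
open import Relation.Unary using (Pred; Decidable)
open import Relation.Binary.PropositionalEquality
  using (_≡_; refl; sym; trans; cong; cong₂; subst; module ≡-Reasoning)

does≡true⇒ : ∀ {P : Set} (P? : Dec P) → does P? ≡ true → P
does≡true⇒ (yes p) _ = p

Xor : Set → Set → Set
Xor P Q = (P × ¬ Q) ⊎ (¬ P × Q)

module _ {A : Set} where

  length-≡-filter-+-filter : {P Q : Pred A 0ℓ} (P? : Decidable P) (Q? : Decidable Q) →
    ∀ xs → (∀ {x} → x ∈ xs → Xor (P x) (Q x)) →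
    length xs ≡ length (filter P? xs) + length (filter Q? xs)
  length-≡-filter-+-filter P? Q? [] _ = refl
  length-≡-filter-+-filter P? Q? (x ∷ xs) xor
    with ih ← length-≡-filter-+-filter P? Q? xs (xor ∘ there) | xor (here refl)
  ... | inj₁ (px , ¬qx) rewrite filter-accept P? {xs = xs} px | filter-reject Q? {xs = xs} ¬qx =
    cong suc ih
  ... | inj₂ (¬px , qx) rewrite filter-reject P? {xs = xs} ¬px | filter-accept Q? {xs = xs} qx =
    trans (cong suc ih) (sym (+-suc _ _))

  ∈-filter-does⇔ : {P : Pred A 0ℓ} (P? : Decidable P) → ∀ {x xs} →
    x ∈ filter (λ y → does (P? y) ≟B true) xs ⇔ (x ∈ xs × P x)
  ∈-filter-does⇔ P? {x} = mk⇔
    (λ x∈ → let x∈xs , P?x≡true = ∈-filter⁻ _ x∈ in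
      x∈xs , does≡true⇒ (P? x) P?x≡true)
    (λ (x∈xs , px) → ∈-filter⁺ _ x∈xs (dec-true (P? x) px))

  module _ (f : A → A) {xs : List A} where

    map-involution-unique : (∀ {x} → x ∈ xs → f (f x) ≡ x) → Unique xs → Unique (map f xs)
    map-involution-unique invol xs! = Unique.map⁻ (subst Unique (sym ff-xs≡xs) xs!)
      where
      ff-xs≡xs : map f (map f xs) ≡ xs
      ff-xs≡xs = trans (sym (map-∘ xs)) (map-id-local (All.tabulate invol))

    length-≡-by-involution : ∀ {ys} → Unique xs → Unique ys →
      (∀ {x} → x ∈ xs → f x ∈ ys × f (f x) ≡ x) →
      (∀ {y} → y ∈ ys → f y ∈ xs × f (f y) ≡ y) →
      length xs ≡ length ys
    length-≡-by-involution {ys} xs! ys! xs→ys ys→xs =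
      trans (sym (length-map f xs))
        (↭-length (∼bag⇒↭ (unique∧set⇒bag (map-involution-unique (proj₂ ∘ xs→ys) xs!) ys!
          (mk⇔ into onto))))
      where
      into : ∀ {z} → z ∈ map f xs → z ∈ ys
      into z∈ with x , x∈xs , refl ← ∈-map⁻ f z∈ = proj₁ (xs→ys x∈xs)
      onto : ∀ {y} → y ∈ ys → y ∈ map f xs
      onto y∈ys = let fy∈xs , ffy≡y = ys→xs y∈ys in subst (_∈ map f xs) ffy≡y (∈-map⁺ f fy∈xs)

module _ {A B C : Set} where

  concatMap-map≡map-cartesianProduct : (f : A × B → C) → ∀ xs ys →
    concatMap (λ x → map (λ y → f (x , y)) ys) xs ≡ map f (cartesianProduct xs ys)
  concatMap-map≡map-cartesianProduct f [] ys = refl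
  concatMap-map≡map-cartesianProduct f (x ∷ xs) ys =
    trans (cong₂ _++_ (map-∘ ys) (concatMap-map≡map-cartesianProduct f xs ys))
          (sym (map-++ f (map (x ,_) ys) (cartesianProduct xs ys)))

m%2≡0⊎m%2≡1 : ∀ n → n % 2 ≡ 0 ⊎ n % 2 ≡ 1
m%2≡0⊎m%2≡1 n with n % 2 | m%n<n n 2
... | 0 | _ = inj₁ refl
... | 1 | _ = inj₂ refl
... | suc (suc _) | s≤s (s≤s ())

Odd : ℕ → Set
Odd n = n % 2 ≡ 1

¬odd⇒even : ∀ n → ¬ Odd n → 2 ∣ n
¬odd⇒even n ¬odd with m%2≡0⊎m%2≡1 n
... | inj₁ n%2≡0 = m%n≡0⇒n∣m n 2 n%2≡0
... | inj₂ n%2≡1 = ⊥-elim (¬odd n%2≡1)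

odd*even≡even-mod4 : ∀ x y → Odd x → 2 ∣ y → x * y % 4 ≡ y % 4
odd*even≡even-mod4 x y x-odd 2∣y = begin
  x * y % 4               ≡⟨ cong (λ x → x * y % 4) x≡1+k*2 ⟩
  (y + x / 2 * 2 * y) % 4 ≡⟨ %-remove-+ʳ y (*-pres-∣ (n∣m*n (x / 2)) 2∣y) ⟩
  y % 4                   ∎
  where
  open ≡-Reasoning
  x≡1+k*2 : x ≡ 1 + x / 2 * 2
  x≡1+k*2 = trans (m≡m%n+[m/n]*n x 2) (cong (_+ x / 2 * 2) x-odd)

even⇒%4∈0,2 : ∀ {a} → 2 ∣ a → a % 4 ≡ 0 ⊎ a % 4 ≡ 2
even⇒%4∈0,2 (divides-refl k) = Sum.map (via-k%2) (via-k%2) (m%2≡0⊎m%2≡1 k)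
  where
  via-k%2 : ∀ {r} → k % 2 ≡ r → k * 2 % 4 ≡ r * 2
  via-k%2 k%2≡r = trans (sym (m%n*o≡m*o%[n*o] k 2 2)) (cong (_* 2) k%2≡r)

even+even≡2-mod4 : ∀ {a b} → 2 ∣ a → 2 ∣ b → (a + b) % 4 ≡ 2 → Xor (a % 4 ≡ 2) (b % 4 ≡ 2)
even+even≡2-mod4 {a} {b} 2∣a 2∣b a+b≡2 =
  residues (even⇒%4∈0,2 2∣a) (even⇒%4∈0,2 2∣b) (trans (sym (%-distribˡ-+ a b 4)) a+b≡2)
  where
  residues : ∀ {r s} → r ≡ 0 ⊎ r ≡ 2 → s ≡ 0 ⊎ s ≡ 2 → (r + s) % 4 ≡ 2 → Xor (r ≡ 2) (s ≡ 2)
  residues (inj₁ refl) (inj₁ refl) ()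
  residues (inj₁ refl) (inj₂ refl) _ = inj₂ ((λ ()) , refl)
  residues (inj₂ refl) (inj₁ refl) _ = inj₁ (refl , λ ())
  residues (inj₂ refl) (inj₂ refl) ()

range1-unique : ∀ N → Unique (range1 N)
range1-unique N = Unique.map⁺ suc-injective (Unique.upTo⁺ N)

∈-range1 : ∀ {N k} → 1 ≤ k → k ≤ N → k ∈ range1 N
∈-range1 {k = suc _} _ k≤N = ∈-map⁺ suc (∈-upTo⁺ k≤N)

quads≡cartesianPower : ∀ N → let R = range1 N in
  quads N ≡ cartesianProduct R (cartesianProduct R (cartesianProduct R R))
quads≡cartesianPower N = begin
  quads N
    ≡⟨ concatMap-cong (λ a → trans
         (concatMap-cong (λ b → concatMap-map≡map-cartesianProduct (λ cd → a , b , cd) R R) R)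
         (concatMap-map≡map-cartesianProduct (λ bcd → a , bcd) R R²)) R ⟩
  concatMap (λ a → map (λ bcd → a , bcd) R³) R
    ≡⟨ concatMap-map≡map-cartesianProduct id R R³ ⟩
  map id (cartesianProduct R R³)
    ≡⟨ map-id _ ⟩
  cartesianProduct R R³ ∎
  where
  open ≡-Reasoning
  R = range1 N
  R² = cartesianProduct R R
  R³ = cartesianProduct R R²

quads-unique : ∀ N → Unique (quads N)
quads-unique N rewrite quads≡cartesianPower N =
  Unique.cartesianProduct⁺ R! (Unique.cartesianProduct⁺ R! (Unique.cartesianProduct⁺ R! R!))
  where R! = range1-unique N

entries-≤ : ∀ {N l₁ m₁ l₂ m₂} → IsTwoSizePartitionOf N (l₁ , m₁ , l₂ , m₂) →
  l₁ ≤ N × m₁ ≤ N × l₂ ≤ N × m₂ ≤ N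
entries-≤ {l₁ = l₁} {m₁} {l₂} {m₂} (l₂<l₁ , 1≤l₂ , 1≤m₁ , 1≤m₂ , refl) =
  ≤-trans (m≤m*n l₁ m₁) (m≤m+n _ _) , ≤-trans (m≤n*m m₁ l₁) (m≤m+n _ _) ,
  ≤-trans (m≤m*n l₂ m₂) (m≤n+m _ _) , ≤-trans (m≤n*m m₂ l₂) (m≤n+m _ _)
  where
  instance
    _ = >-nonZero (≤-trans 1≤l₂ (<⇒≤ l₂<l₁))
    _ = >-nonZero 1≤m₁
    _ = >-nonZero 1≤l₂
    _ = >-nonZero 1≤m₂

twoSizePartition∈quads : ∀ {N q} → IsTwoSizePartitionOf N q → q ∈ quads N
twoSizePartition∈quads {N} {l₁ , m₁ , l₂ , m₂} q@(l₂<l₁ , 1≤l₂ , 1≤m₁ , 1≤m₂ , _)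
  with l₁≤N , m₁≤N , l₂≤N , m₂≤N ← entries-≤ q =
  subst (_ ∈_) (sym (quads≡cartesianPower N))
    (∈-cartesianProduct⁺ (∈-range1 (≤-trans 1≤l₂ (<⇒≤ l₂<l₁)) l₁≤N)
      (∈-cartesianProduct⁺ (∈-range1 1≤m₁ m₁≤N)
        (∈-cartesianProduct⁺ (∈-range1 1≤l₂ l₂≤N) (∈-range1 1≤m₂ m₂≤N))))

-- does (IsTwoSizePartitionOf? N q) and does (IsOEEO? q) compute to the Booleans
-- isTwoSizePartitionOf? N q and isOEEO q by which Defs filters its lists.
IsTwoSizePartitionOf? : ∀ N q → Dec (IsTwoSizePartitionOf N q)
IsTwoSizePartitionOf? N (l₁ , m₁ , l₂ , m₂) =
  l₂ <? l₁ ×-dec 1 ≤? l₂ ×-dec 1 ≤? m₁ ×-dec 1 ≤? m₂ ×-dec l₁ * m₁ + l₂ * m₂ ≟ N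

IsOEEO : Quad → Set
IsOEEO (l₁ , m₁ , l₂ , m₂) = Odd l₁ × ¬ Odd m₁ × ¬ Odd l₂ × Odd m₂

IsOEEO? : ∀ q → Dec (IsOEEO q)
IsOEEO? (l₁ , m₁ , l₂ , m₂) =
  l₁ % 2 ≟ 1 ×-dec ¬? (m₁ % 2 ≟ 1) ×-dec ¬? (l₂ % 2 ≟ 1) ×-dec m₂ % 2 ≟ 1

∈-twoSizePartitions⇔ : ∀ N {q} → q ∈ twoSizePartitions N ⇔ IsTwoSizePartitionOf N q
∈-twoSizePartitions⇔ N {q} = mk⇔ (proj₂ ∘ Equivalence.to ∈-filter)
  (λ p → Equivalence.from ∈-filter (twoSizePartition∈quads p , p))
  where ∈-filter = ∈-filter-does⇔ (IsTwoSizePartitionOf? N) {q} {quads N}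

∈-oeeo⇔ : ∀ N {q} → q ∈ oeeo N ⇔ (IsTwoSizePartitionOf N q × IsOEEO q)
∈-oeeo⇔ N {q} = mk⇔
  (λ q∈ → let q∈tsp , oeeo = Equivalence.to ∈-filter q∈ in
    Equivalence.to (∈-twoSizePartitions⇔ N) q∈tsp , oeeo)
  (λ (p , oeeo) → Equivalence.from ∈-filter (Equivalence.from (∈-twoSizePartitions⇔ N) p , oeeo))
  where ∈-filter = ∈-filter-does⇔ IsOEEO? {q} {twoSizePartitions N}

oeeo-unique : ∀ N → Unique (oeeo N)
oeeo-unique N = Unique.filter⁺ _ (Unique.filter⁺ _ (quads-unique N))

conjugate : Quad → Quad
conjugate (l₁ , m₁ , l₂ , m₂) = (m₁ + m₂ , l₂ , m₁ , l₁ ∸ l₂)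

conjugate-involutive : ∀ {l₁ m₁ l₂ m₂} → l₂ ≤ l₁ →
  conjugate (conjugate (l₁ , m₁ , l₂ , m₂)) ≡ (l₁ , m₁ , l₂ , m₂)
conjugate-involutive {l₁} {m₁} {l₂} {m₂} l₂≤l₁ =
  cong₂ (λ l m → l , m₁ , l₂ , m) (m+[n∸m]≡n l₂≤l₁) (m+n∸m≡n m₁ m₂)

conjugate-isTwoSizePartitionOf : ∀ {N q} →
  IsTwoSizePartitionOf N q → IsTwoSizePartitionOf N (conjugate q)
conjugate-isTwoSizePartitionOf {N} {l₁ , m₁ , l₂ , m₂} (l₂<l₁ , 1≤l₂ , 1≤m₁ , 1≤m₂ , size) =
  m<m+n m₁ 1≤m₂ , 1≤m₁ , 1≤l₂ , m<n⇒0<n∸m l₂<l₁ , size′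
  where
  open ≡-Reasoning
  column-count : ∀ m₁ m₂ l₂ e → (m₁ + m₂) * l₂ + m₁ * e ≡ (l₂ + e) * m₁ + l₂ * m₂
  column-count = solve-∀
  size′ : (m₁ + m₂) * l₂ + m₁ * (l₁ ∸ l₂) ≡ N
  size′ = begin
    (m₁ + m₂) * l₂ + m₁ * (l₁ ∸ l₂)     ≡⟨ column-count m₁ m₂ l₂ (l₁ ∸ l₂) ⟩
    (l₂ + (l₁ ∸ l₂)) * m₁ + l₂ * m₂     ≡⟨ cong (λ l → l * m₁ + l₂ * m₂) (m+[n∸m]≡n (<⇒≤ l₂<l₁)) ⟩
    l₁ * m₁ + l₂ * m₂                   ≡⟨ size ⟩
    N                                   ∎

conjugate-isOEEO : ∀ {l₁ m₁ l₂ m₂} → l₂ ≤ l₁ →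
  IsOEEO (l₁ , m₁ , l₂ , m₂) → IsOEEO (conjugate (l₁ , m₁ , l₂ , m₂))
conjugate-isOEEO {l₁} {m₁} {l₂} {m₂} l₂≤l₁ (l₁-odd , m₁-even , l₂-even , m₂-odd) =
  trans (%-remove-+ˡ m₂ (¬odd⇒even m₁ m₁-even)) m₂-odd , l₂-even , m₁-even ,
  trans (sym (%-remove-+ˡ (l₁ ∸ l₂) (¬odd⇒even l₂ l₂-even)))
        (subst Odd (sym (m+[n∸m]≡n l₂≤l₁)) l₁-odd)

conjugate-∈-oeeo : ∀ N {q} → q ∈ oeeo N → conjugate q ∈ oeeo N × conjugate (conjugate q) ≡ q
conjugate-∈-oeeo N {l₁ , m₁ , l₂ , m₂} q∈
  with p@(l₂<l₁ , _) , oeeo ← Equivalence.to (∈-oeeo⇔ N) q∈ =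
  Equivalence.from (∈-oeeo⇔ N)
    (conjugate-isTwoSizePartitionOf p , conjugate-isOEEO {l₁} {m₁} {l₂} {m₂} (<⇒≤ l₂<l₁) oeeo) ,
  conjugate-involutive (<⇒≤ l₂<l₁)

IsOEEO⇒products≡mod4 : ∀ {l₁ m₁ l₂ m₂} → IsOEEO (l₁ , m₁ , l₂ , m₂) →
  l₁ * m₁ % 4 ≡ m₁ % 4 × l₂ * m₂ % 4 ≡ l₂ % 4
IsOEEO⇒products≡mod4 {l₁} {m₁} {l₂} {m₂} (l₁-odd , m₁-even , l₂-even , m₂-odd) =
  odd*even≡even-mod4 l₁ m₁ l₁-odd (¬odd⇒even m₁ m₁-even) ,
  trans (cong (_% 4) (*-comm l₂ m₂)) (odd*even≡even-mod4 m₂ l₂ m₂-odd (¬odd⇒even l₂ l₂-even))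

First2 Second2 : Quad → Set
First2 (l₁ , m₁ , _ , _) = l₁ * m₁ % 4 ≡ 2
Second2 (_ , _ , l₂ , m₂) = l₂ * m₂ % 4 ≡ 2

conjugate-swaps-First2-Second2 : ∀ N {q} → q ∈ oeeo N →
  (First2 q → Second2 (conjugate q)) × (Second2 q → First2 (conjugate q))
conjugate-swaps-First2-Second2 N {l₁ , m₁ , l₂ , m₂} q∈
  with _ , q-oeeo ← Equivalence.to (∈-oeeo⇔ N) q∈
     | _ , q′-oeeo ← Equivalence.to (∈-oeeo⇔ N) (proj₁ (conjugate-∈-oeeo N q∈))
  with l₁m₁≡m₁ , l₂m₂≡l₂ ← IsOEEO⇒products≡mod4 {l₁} {m₁} {l₂} {m₂} q-oeeo
     | [m₁+m₂]l₂≡l₂ , m₁[l₁∸l₂]≡m₁ ← IsOEEO⇒products≡mod4 {m₁ + m₂} {l₂} {m₁} {l₁ ∸ l₂} q′-oeeo =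
  (λ first2 → trans m₁[l₁∸l₂]≡m₁ (trans (sym l₁m₁≡m₁) first2)) ,
  (λ second2 → trans [m₁+m₂]l₂≡l₂ (trans (sym l₂m₂≡l₂) second2))

oeeo-first2→second2 : ∀ N {q} → q ∈ oeeo-first2 N →
  conjugate q ∈ oeeo-second2 N × conjugate (conjugate q) ≡ q
oeeo-first2→second2 N {_ , _ , _ , _} q∈ with q∈oeeo , first2 ← ∈-filter⁻ _ {xs = oeeo N} q∈ =
  ∈-filter⁺ _ (proj₁ (conjugate-∈-oeeo N q∈oeeo))
    (proj₁ (conjugate-swaps-First2-Second2 N q∈oeeo) first2) ,
  proj₂ (conjugate-∈-oeeo N q∈oeeo)

oeeo-second2→first2 : ∀ N {q} → q ∈ oeeo-second2 N →
  conjugate q ∈ oeeo-first2 N × conjugate (conjugate q) ≡ q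
oeeo-second2→first2 N {_ , _ , _ , _} q∈ with q∈oeeo , second2 ← ∈-filter⁻ _ {xs = oeeo N} q∈ =
  ∈-filter⁺ _ (proj₁ (conjugate-∈-oeeo N q∈oeeo))
    (proj₂ (conjugate-swaps-First2-Second2 N q∈oeeo) second2) ,
  proj₂ (conjugate-∈-oeeo N q∈oeeo)

oeeo-First2-xor-Second2 : ∀ N {q} → N % 4 ≡ 2 → q ∈ oeeo N → Xor (First2 q) (Second2 q)
oeeo-First2-xor-Second2 N {l₁ , m₁ , l₂ , m₂} N≡2 q∈
  with (_ , _ , _ , _ , size) , (_ , m₁-even , l₂-even , _) ← Equivalence.to (∈-oeeo⇔ N) q∈ =
  even+even≡2-mod4 (∣n⇒∣m*n l₁ (¬odd⇒even m₁ m₁-even)) (∣m⇒∣m*n m₂ (¬odd⇒even l₂ l₂-even))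
    (trans (cong (_% 4) size) N≡2)

lemma3p2 : (N : ℕ) → N % 4 ≡ 2 →
    (2 ∣ length (oeeo N)) × (length (oeeo-first2 N) ≡ length (oeeo-second2 N))
lemma3p2 N N≡2 = divides #second2 oeeo≡second2*2 , first2≡second2
  where
  open ≡-Reasoning
  #first2 #second2 : ℕ
  #first2 = length (oeeo-first2 N)
  #second2 = length (oeeo-second2 N)
  m+m≡m*2 : ∀ m → m + m ≡ m * 2
  m+m≡m*2 = solve-∀
  first2≡second2 : #first2 ≡ #second2
  first2≡second2 = length-≡-by-involution conjugate
    (Unique.filter⁺ _ (oeeo-unique N)) (Unique.filter⁺ _ (oeeo-unique N))
    (oeeo-first2→second2 N) (oeeo-second2→first2 N)
  oeeo≡second2*2 : length (oeeo N) ≡ #second2 * 2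
  oeeo≡second2*2 = begin
    length (oeeo N)      ≡⟨ length-≡-filter-+-filter _ _ (oeeo N) (oeeo-First2-xor-Second2 N N≡2) ⟩
    #first2 + #second2   ≡⟨ cong (_+ #second2) first2≡second2 ⟩
    #second2 + #second2  ≡⟨ m+m≡m*2 #second2 ⟩
    #second2 * 2         ∎
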